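{- Let $M=(\Sigma,A_{S_0},T_R)$ be a regular system, $\mathit{COP}=\{cop_1,\dots,cop_k\}$ a set of state properties, $gsp$ a global system property over $\mathit{COP}$, and $M^a_{\neg gsp}=(\Sigma^a,A^a_{S_0},T^a_R,F^a)$ the Büchi regular system constructed from them as in the context, with relation $R^a$. If $M^a_{\neg gsp}$ is locally finite, then $M^a_{\neg gsp}$ is empty (has no accepting execution) if and only if $$L\big((T^a_R)^*(A^a_{S_0})\cap F^a\cap \Pi_{\neq 2}((T^a_R)^+\cap T_{id})\big)=\emptyset,$$ i.e. iff there is no word $w\in(\Sigma^a)^*$ such that $w$ is reachable from $L(A^a_{S_0})$ by zero or more $R^a$-steps, $w\in L(F^a)$, and $(w,w)\in(R^a)^+$.
   Context: A regular system $M=(\Sigma,A_{S_0},T_R)$ consists of a finite alphabet $\Sigma$, a deterministic finite-word automaton $A_{S_0}$ over $\Sigma$ (the initial states are the words of $L(A_{S_0})$) and a deterministic finite-word transducer $T_R=(Q_R,\Sigma\times\Sigma,q_{0R},\delta_R,F_R)$ over $\Sigma\times\Sigma$, representing the relation $R$ of pairs $(u,v)$ of words of equal length $n$ such that $(u(0),v(0))\cdots(u(n-1),v(n-1))$ is accepted. An execution of $M$ is an infinite sequence $w_0w_1\cdots$ with $w_0\in L(A_{S_0})$ and $(w_i,w_{i+1})\in R$; all executions are assumed infinite. Each state property $cop_i\subseteq\Sigma^*$ is recognized by a complete deterministic finite-word automaton $A_{cop_i}=(Q_{cop_i},\Sigma,q_{0,cop_i},\delta_{cop_i},F_{cop_i})$;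 $\mathbf{cop}(w)=\{cop_i\mid w\in cop_i\}$. A global system property $gsp\subseteq(2^{\mathit{COP}})^\omega$ is recognized by a Büchi automaton, and $A_{\neg gsp}=(Q_{\neg gsp},2^{\mathit{COP}},q_{0,\neg gsp},\Delta_{\neg gsp},F_{\neg gsp})$ is a complete Büchi automaton for $(2^{\mathit{COP}})^\omega\setminus gsp$. Construction: $\Sigma^a=\Sigma\times(Q_{\neg gsp}\cup\{\bot\})\times(2^{\mathit{COP}}\cup\{\bot\})$. The transducer $T^a_R$ has states $Q_R\times\prod_{i=1}^kQ_{cop_i}\times\{0,1\}$, initial state $(q_{0R},q_{0,cop_1},\dots,q_{0,cop_k},0)$, accepting states $F_R\times\prod_iQ_{cop_i}\times\{1\}$, and a transition from $(q_R,q_1,\dots,q_k,b)$ to $(q_R',q_1',\dots,q_k',b')$ on $((a_1,\alpha_1,\lambda_1),(a_2,\alpha_2,\lambda_2))$ iff $q_R'\in\delta_R(q_R,(a_1,a_2))$, $q_i'=\delta_{cop_i}(q_i,a_1)$ for all $i$, and $b'=1$ exactly when $\alpha_1,\lambda_1,\alpha_2,\lambda_2\neq\bot$, $\alpha_2\in\Delta_{\neg gsp}(\alpha_1,\lambda_1)$ and for every $i$: $q_i'\in F_{cop_i}$ iff $cop_i\in\lambda_1$ (else $b'=0$). $R^a$ is the set of equal-length word pairs over $\Sigma^a$ accepted by $T^a_R$; $(R^a)^+$ its transitive closure; $T_{id}$ the identity transducer on $(\Sigma^a)^*$; $\Pi_{\neq2}$ of a set of pairs is the set of first components; $(T^a_R)^*(A^a_{S_0})$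 is the set of words reachable from $L(A^a_{S_0})$ in zero or more $R^a$-steps. $L(A^a_{S_0})$ consists of the words $(w(0),\bot,\bot)\cdots(w(n-2),\bot,\bot)(w(n-1),q_{0,\neg gsp},\lambda)$ with $w(0)\cdots w(n-1)\in L(A_{S_0})$, $\lambda\in2^{\mathit{COP}}$; $L(F^a)=(\Sigma\times\{\bot\}\times\{\bot\})^*(\Sigma\times F_{\neg gsp}\times2^{\mathit{COP}})$. An execution of $M^a_{\neg gsp}$ is an infinite sequence $w^a_0w^a_1\cdots$ with $w^a_0\in L(A^a_{S_0})$, $(w^a_i,w^a_{i+1})\in R^a$; it is accepting if infinitely many $w^a_i\in L(F^a)$; the system is empty if it has no accepting execution. It is locally finite if every execution starting from any reachable word visits only finitely many distinct words. -}

module Defs where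

open import Data.Nat using (ℕ; zero; suc; _≤_)
open import Data.Fin using (Fin)
open import Data.Fin.Subset using (Subset)
open import Data.Bool using (Bool; true; false)
open import Data.Maybe using (Maybe; just; nothing; _>>=_)
open import Data.Vec using (Vec; []; _∷_; lookup; map)
open import Data.List using (List)
open import Data.List.Membership.Propositional using (_∈_)
open import Data.Product using (Σ; ∃; ∃-syntax; _×_; _,_; proj₁; proj₂)
open import Data.Empty using (⊥)
open import Relation.Binary.PropositionalEquality using (_≡_)
open import Relation.Binary.Construct.Closure.ReflexiveTransitive using (Star)
open import Relation.Binary.Construct.Closure.Transitive using (TransClosure)
open import Relation.Nullary using (¬_)

-- Input data.  All finite sets are represented as Fin _.
-- Words of length n over an alphabet A are Vec A n; relations given by
-- transducers only relate words of equal length.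

record RegularSystem : Set where
  field
    s   : ℕ
    -- deterministic (possibly partial) automaton A_S0
    p   : ℕ
    q0S : Fin p
    δS  : Fin p → Fin s → Maybe (Fin p)
    FS  : Fin p → Bool
    -- deterministic (possibly partial) transducer T_R over Σ × Σ
    r   : ℕ
    q0R : Fin r
    δR  : Fin r → Fin s → Fin s → Maybe (Fin r)
    FR  : Fin r → Bool

-- k state properties cop_1..cop_k over Σ = Fin s, each given by a
-- complete deterministic automaton A_cop_i.
record StateProps (s : ℕ) : Set where
  field
    k   : ℕ
    c   : Fin k → ℕ
    q0c : (i : Fin k) → Fin (c i)
    δc  : (i : Fin k) → Fin (c i) → Fin s → Fin (c i)
    Fc  : (i : Fin k) → Fin (c i) → Bool

-- A Büchi automaton over 2^COP = Subset k (the automaton A_¬gsp).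
record Buchi (k : ℕ) : Set where
  field
    m   : ℕ
    q0B : Fin m
    ΔB  : Fin m → Subset k → Fin m → Bool
    FB  : Fin m → Bool

Complete : ∀ {k} → Buchi k → Set
Complete B = ∀ q (l : Subset _) → ∃[ q' ] (ΔB q l q' ≡ true)
  where open Buchi B

record Transducer (A : Set) : Set₁ where
  field
    Q   : Set
    qi  : Q
    Δ   : Q → A → A → Q → Set
    Acc : Q → Set

data AcceptsFrom {A : Set} (T : Transducer A) :
       Transducer.Q T → ∀ {n} → Vec A n → Vec A n → Set where
  done : ∀ {q} → Transducer.Acc T q → AcceptsFrom T q [] []
  step : ∀ {q q' n a b} {u v : Vec A n} →
         Transducer.Δ T q a b q' → AcceptsFrom T q' u v →
         AcceptsFrom T q (a ∷ u) (b ∷ v)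

RelOf : ∀ {A} → Transducer A → ∀ n → Vec A n → Vec A n → Set
RelOf T n u v = AcceptsFrom T (Transducer.qi T) u v

module System (M : RegularSystem) where
  open RegularSystem M

  Sym : Set
  Sym = Fin s

  runS : ∀ {n} → Fin p → Vec Sym n → Maybe (Fin p)
  runS q []      = just q
  runS q (a ∷ w) = δS q a >>= λ q' → runS q' w

  InS0 : ∀ {n} → Vec Sym n → Set
  InS0 w = ∃[ q ] (runS q0S w ≡ just q × FS q ≡ true)

  TR : Transducer Sym
  TR = record { Q = Fin r ; qi = q0R
              ; Δ = λ q a b q' → δR q a b ≡ just q'
              ; Acc = λ q → FR q ≡ true }

  R : ∀ n → Vec Sym n → Vec Sym n → Set
  R = RelOf TR

  ReachableM : ∀ {n} → Vec Sym n → Set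
  ReachableM {n} w = ∃[ w0 ] (InS0 w0 × Star (R n) w0 w)

  NoDeadlock : Set
  NoDeadlock = ∀ n (w : Vec Sym n) → ReachableM w → ∃[ v ] R n w v

module Construction (M : RegularSystem)
                    (P : StateProps (RegularSystem.s M))
                    (B : Buchi (StateProps.k P)) where
  open RegularSystem M
  open StateProps P
  open Buchi B

  -- Σ^a = Σ × (Q_¬gsp ∪ {⊥}) × (2^COP ∪ {⊥}),  ⊥ = nothing
  Σa : Set
  Σa = Fin s × Maybe (Fin m) × Maybe (Subset k)

  Qa : Set
  Qa = Fin r × ((i : Fin k) → Fin (c i)) × Bool

  -- the condition for b' = 1, given the successor cop-states qs'
  Cond : ((i : Fin k) → Fin (c i)) → Σa → Σa → Set
  Cond qs' (a₁ , α₁ , λ₁) (a₂ , α₂ , λ₂) =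
    Σ (Fin m) λ q₁ → Σ (Subset k) λ l₁ → Σ (Fin m) λ q₂ → Σ (Subset k) λ l₂ →
      α₁ ≡ just q₁ × λ₁ ≡ just l₁ × α₂ ≡ just q₂ × λ₂ ≡ just l₂ ×
      ΔB q₁ l₁ q₂ ≡ true ×
      (∀ i → Fc i (qs' i) ≡ lookup l₁ i)

  ΔTa : Qa → Σa → Σa → Qa → Set
  ΔTa (qR , qs , b) x y (qR' , qs' , b') =
    δR qR (proj₁ x) (proj₁ y) ≡ just qR' ×
    (∀ i → qs' i ≡ δc i (qs i) (proj₁ x)) ×
    ((b' ≡ true → Cond qs' x y) × (Cond qs' x y → b' ≡ true))

  Ta : Transducer Σa
  Ta = record { Q = Qa
              ; qi = (q0R , q0c , false)
              ; Δ = ΔTa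
              ; Acc = λ { (qR , qs , b) → FR qR ≡ true × b ≡ true } }

  Ra : ∀ n → Vec Σa n → Vec Σa n → Set
  Ra = RelOf Ta

  -- L(A^a_S0): (w(0),⊥,⊥)…(w(n-2),⊥,⊥)(w(n-1),q_0¬gsp,λ), w ∈ L(A_S0)
  InitShape : ∀ {n} → Vec Σa n → Set
  InitShape []           = ⊥
  InitShape (x ∷ [])     = ∃[ l ] (proj₂ x ≡ (just q0B , just l))
  InitShape (x ∷ y ∷ w)  = proj₂ x ≡ (nothing , nothing) × InitShape (y ∷ w)

  InitA : ∀ {n} → Vec Σa n → Set
  InitA w = System.InS0 M (map proj₁ w) × InitShape w

  -- L(F^a) = (Σ×{⊥}×{⊥})^* (Σ × F_¬gsp × 2^COP)
  InF : ∀ {n} → Vec Σa n → Set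
  InF []          = ⊥
  InF (x ∷ [])    = Σ (Fin m) λ q → Σ (Subset k) λ l →
                      proj₂ x ≡ (just q , just l) × FB q ≡ true
  InF (x ∷ y ∷ w) = proj₂ x ≡ (nothing , nothing) × InF (y ∷ w)

  Reachable : ∀ {n} → Vec Σa n → Set
  Reachable {n} w = ∃[ w0 ] (InitA w0 × Star (Ra n) w0 w)

  -- executions (all words of an execution have the same length n)
  IsExecution : ∀ n → (ℕ → Vec Σa n) → Set
  IsExecution n e = InitA (e 0) × (∀ i → Ra n (e i) (e (suc i)))

  IsAccepting : ∀ n → (ℕ → Vec Σa n) → Set
  IsAccepting n e = ∀ N → ∃[ i ] (N ≤ i × InF (e i))

  Empty : Set
  Empty = ¬ (Σ ℕ λ n → Σ (ℕ → Vec Σa n) λ e → IsExecution n e × IsAccepting n e)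

  LocallyFinite : Set
  LocallyFinite = ∀ n (w : Vec Σa n) → Reachable w →
                  (e : ℕ → Vec Σa n) → e 0 ≡ w →
                  (∀ i → Ra n (e i) (e (suc i))) →
                  ∃[ L ] (∀ i → e i ∈ L)

  LassoLanguageEmpty : Set
  LassoLanguageEmpty =
    ¬ (Σ ℕ λ n → Σ (Vec Σa n) λ w →
         Reachable w × InF w × TransClosure (Ra n) w w)

-- Nothing about automata or transducers is needed: the statement is an
-- instance of two facts about an arbitrary relation _⟶_ on a set, proved
-- first in the module Paths.
--   * A lasso x ⟶* w ⟶⁺ w unfolds into an infinite path from x that
--     visits w infinitely often (walk the stem, then repeat the cycle).
--   * An infinite path whose words all lie in a finite list and which
--     satisfies P infinitely often contains a recurrent P-point: by the
--     pigeonhole principle two of its P-positions i < j carry the same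
--     word, so e i ⟶⁺ e j = e i.
-- The theorem follows: an accepting lasso yields an accepting execution,
-- and local finiteness (applied to an accepting execution from its first
-- word) turns an accepting execution into an accepting lasso.
module Submission where

open import Defs
open import Function.Bundles using (_⇔_; mk⇔)
open import Level using (Level)
open import Data.Nat using (ℕ; zero; suc; _+_; _≤_; _<_; _≤′_; ≤′-refl; ≤′-step; z≤n)
open import Data.Nat.Properties using (≤⇒≤′; <⇒<′; m≤m+n; <-trans; n<1+n)
open import Data.Nat.GeneralisedArithmetic using (iterate)
open import Data.Fin using (toℕ)
open import Data.Fin.Properties using (pigeonhole)
open import Data.List using (List; length; lookup)
open import Data.List.Membership.Propositional using (_∈_)
open import Data.List.Relation.Unary.Any using (index)
open import Data.List.Relation.Unary.Any.Properties using (lookup-index)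
open import Data.Product using (Σ; ∃₂; ∃-syntax; _×_; _,_; proj₁; proj₂)
open import Relation.Binary using (Rel)
open import Relation.Binary.PropositionalEquality
  using (_≡_; refl; sym; trans; cong; subst; module ≡-Reasoning)
open import Relation.Binary.Construct.Closure.ReflexiveTransitive using (Star; ε; _◅_; _◅◅_)
open import Relation.Binary.Construct.Closure.Transitive using (TransClosure; [_]; _∷_)

private
  variable
    a p ℓ : Level

iterate-+ : {A : Set a} (f : A → A) (x : A) (m n : ℕ) →
            iterate f x (m + n) ≡ iterate f (iterate f x m) n
iterate-+ f x zero    n = refl
iterate-+ f x (suc m) n = iterate-+ f (f x) m n

iterate-suc : {A : Set a} (f : A → A) (x : A) (n : ℕ) →
              iterate f x (suc n) ≡ f (iterate f x n)
iterate-suc f x zero    = refl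
iterate-suc f x (suc n) = iterate-suc f (f x) n

sequence-repeats : {X : Set a} (f : ℕ → X) (L : List X) → (∀ k → f k ∈ L) →
                   ∃₂ λ i j → i < j × f i ≡ f j
sequence-repeats f L f∈L with pigeonhole (n<1+n (length L)) (λ k → index (f∈L (toℕ k)))
... | i , j , i<j , same-index = toℕ i , toℕ j , i<j , same-value
  where
  open ≡-Reasoning
  same-value : f (toℕ i) ≡ f (toℕ j)
  same-value = begin
    f (toℕ i)                       ≡⟨ lookup-index (f∈L (toℕ i)) ⟩
    lookup L (index (f∈L (toℕ i)))  ≡⟨ cong (lookup L) same-index ⟩
    lookup L (index (f∈L (toℕ j)))  ≡⟨ sym (lookup-index (f∈L (toℕ j))) ⟩
    f (toℕ j)                       ∎

StrictlyIncreasing : (ℕ → ℕ) → Set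
StrictlyIncreasing g = ∀ k → g k < g (suc k)

strictly-increasing-mono : ∀ {g} → StrictlyIncreasing g → ∀ {i j} → i < j → g i < g j
strictly-increasing-mono {g} inc {i} i<j = go (<⇒<′ i<j)
  where
  go : ∀ {j} → suc i ≤′ j → g i < g j
  go ≤′-refl      = inc i
  go (≤′-step le) = <-trans (go le) (inc _)

module Paths {A : Set a} (_⟶_ : Rel A ℓ) where

  _⟶*_ : Rel A _
  _⟶*_ = Star _⟶_

  _⟶⁺_ : Rel A _
  _⟶⁺_ = TransClosure _⟶_

  step-star⇒plus : ∀ {x y z} → x ⟶ y → y ⟶* z → x ⟶⁺ z
  step-star⇒plus x⟶y ε           = [ x⟶y ]
  step-star⇒plus x⟶y (y⟶u ◅ u⟶*z) = x⟶y ∷ step-star⇒plus y⟶u u⟶*z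

  plus⇒step-star : ∀ {x z} → x ⟶⁺ z → ∃[ y ] (x ⟶ y × y ⟶* z)
  plus⇒step-star [ x⟶z ]       = _ , x⟶z , ε
  plus⇒step-star (x⟶y ∷ y⟶⁺z) =
    let (u , y⟶u , u⟶*z) = plus⇒step-star y⟶⁺z in _ , x⟶y , y⟶u ◅ u⟶*z

  IsPath : (ℕ → A) → Set ℓ
  IsPath e = ∀ i → e i ⟶ e (suc i)

  InfinitelyOften : (A → Set p) → (ℕ → A) → Set p
  InfinitelyOften P e = ∀ N → ∃[ i ] (N ≤ i × P (e i))

  path-star : ∀ {e} → IsPath e → ∀ {i j} → i ≤ j → e i ⟶* e j
  path-star {e} path {i} i≤j = go (≤⇒≤′ i≤j)
    where
    go : ∀ {j} → i ≤′ j → e i ⟶* e j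
    go ≤′-refl      = ε
    go (≤′-step le) = go le ◅◅ (path _ ◅ ε)

  path-plus : ∀ {e} → IsPath e → ∀ {i j} → i < j → e i ⟶⁺ e j
  path-plus path {i} i<j = step-star⇒plus (path i) (path-star path i<j)

  -- Unfolding a lasso x ⟶* w ⟶⁺ w.  The state of the walk is the
  -- current element together with the remaining path to w; on reaching w
  -- the walk restarts along the cycle.
  module Lasso {w : A} (cycle : w ⟶⁺ w) where

    Pending : Set _
    Pending = Σ A (λ u → u ⟶* w)

    advance : Pending → Pending
    advance (u , ε)        = let (y , _ , y⟶*w) = plus⇒step-star cycle in y , y⟶*w
    advance (u , _ ◅ rest) = _ , rest

    advance-step : ∀ t → proj₁ t ⟶ proj₁ (advance t)
    advance-step (u , ε)       = proj₁ (proj₂ (plus⇒step-star cycle))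
    advance-step (u , u⟶v ◅ _) = u⟶v

    distance : ∀ {u} → u ⟶* w → ℕ
    distance ε          = 0
    distance (_ ◅ rest) = suc (distance rest)

    advance-reaches : ∀ {u} (rest : u ⟶* w) →
                      proj₁ (iterate advance (u , rest) (distance rest)) ≡ w
    advance-reaches ε          = refl
    advance-reaches (_ ◅ rest) = advance-reaches rest

    walk : Pending → ℕ → A
    walk t i = proj₁ (iterate advance t i)

    walk-path : ∀ t → IsPath (walk t)
    walk-path t i = subst (λ s → walk t i ⟶ proj₁ s)
                          (sym (iterate-suc advance t i))
                          (advance-step (iterate advance t i))

    walk-visits : ∀ {P : A → Set p} → P w → ∀ t → InfinitelyOften P (walk t)
    walk-visits {P = P} Pw t N = N + distance (proj₂ now) , m≤m+n N _ , subst P (sym at-w) Pw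
      where
      now : Pending
      now = iterate advance t N
      at-w : walk t (N + distance (proj₂ now)) ≡ w
      at-w = trans (cong proj₁ (iterate-+ advance t N _)) (advance-reaches (proj₂ now))

  unfold-lasso : ∀ {x w} {P : A → Set p} → x ⟶* w → w ⟶⁺ w → P w →
                 Σ (ℕ → A) λ e → e 0 ≡ x × IsPath e × InfinitelyOften P e
  unfold-lasso {x = x} {P = P} stem cycle Pw =
    walk (x , stem) , refl , walk-path (x , stem) , walk-visits {P = P} Pw (x , stem)
    where open Lasso cycle

  occurrences : ∀ {P : A → Set p} {e} → InfinitelyOften P e →
                Σ (ℕ → ℕ) λ g → StrictlyIncreasing g × (∀ k → P (e (g k)))
  occurrences {P = P} {e} often = g , (λ k → proj₁ (proj₂ (next (suc k)))) , found
    where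
    -- the k-th occurrence is searched for beyond the (k-1)-th one
    lower-bound : ℕ → ℕ
    next : ∀ k → ∃[ i ] (lower-bound k ≤ i × P (e i))
    g : ℕ → ℕ
    lower-bound zero    = 0
    lower-bound (suc k) = suc (g k)
    next k = often (lower-bound k)
    g k = proj₁ (next k)
    found : ∀ k → P (e (g k))
    found k = proj₂ (proj₂ (next k))

  recurrent-point : ∀ {P : A → Set p} {e} (L : List A) → (∀ i → e i ∈ L) →
                    IsPath e → InfinitelyOften P e →
                    ∃[ i ] (P (e i) × e i ⟶⁺ e i)
  recurrent-point {P = P} {e} L e∈L path often
    with occurrences {P = P} often
  ... | g , increasing , found
    with sequence-repeats (λ k → e (g k)) L (λ k → e∈L (g k))
  ... | k , l , k<l , same =
    g k , found k ,
    subst (e (g k) ⟶⁺_) (sym same) (path-plus path (strictly-increasing-mono increasing k<l))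

module BuchiEmptiness (M : RegularSystem) (P : StateProps (RegularSystem.s M))
                      (B : Buchi (StateProps.k P)) where
  open Construction M P B

  module _ {n : ℕ} where
    open Paths (Ra n)

    lasso⇒accepting-execution : ∀ {w} → Reachable w → InF w → w ⟶⁺ w →
                                ∃[ e ] (IsExecution n e × IsAccepting n e)
    lasso⇒accepting-execution (w₀ , init , stem) w∈F cycle
      with unfold-lasso {P = InF} stem cycle w∈F
    ... | e , e₀≡w₀ , path , accepting =
      e , (subst InitA (sym e₀≡w₀) init , path) , accepting

    accepting-execution⇒lasso : LocallyFinite → ∀ {e} →
                                IsExecution n e → IsAccepting n e →
                                ∃[ w ] (Reachable w × InF w × w ⟶⁺ w)
    accepting-execution⇒lasso finite {e} (init , path) accepting
      with finite n (e 0) (e 0 , init , ε) e refl path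
    ... | L , e∈L with recurrent-point {P = InF} L e∈L path accepting
    ... | i , eᵢ∈F , cycle = e i , (e 0 , init , path-star path z≤n) , eᵢ∈F , cycle

  empty⇒no-lasso : Empty → LassoLanguageEmpty
  empty⇒no-lasso empty (n , w , reachable , w∈F , cycle) =
    let (e , execution , accepting) = lasso⇒accepting-execution reachable w∈F cycle
    in empty (n , e , execution , accepting)

  no-lasso⇒empty : LocallyFinite → LassoLanguageEmpty → Empty
  no-lasso⇒empty finite no-lasso (n , e , execution , accepting) =
    no-lasso (n , accepting-execution⇒lasso finite execution accepting)

-- Deadlock freedom of M and completeness of A_¬gsp are standing
-- assumptions of the paper; the equivalence does not depend on them.
proposition19 : (M : RegularSystem) (P : StateProps (RegularSystem.s M))
                (B : Buchi (StateProps.k P)) →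
                System.NoDeadlock M →
                Complete B →
                Construction.LocallyFinite M P B →
                (Construction.Empty M P B ⇔ Construction.LassoLanguageEmpty M P B)
proposition19 M P B _ _ locally-finite =
  mk⇔ empty⇒no-lasso (no-lasso⇒empty locally-finite)
  where open BuchiEmptiness M P B
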